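{- Let $M_1=(S_1,r_1)$ and $M_2=(S_2,r_2)$ be matroids and let $\alpha:\mathcal{F}(M_1)\to\mathcal{F}(M_2)$ be a lattice isomorphism satisfying $|\alpha(F)|=|F|$ for all $F\in\mathcal{F}(M_1)$. Then $M_1\cong M_2$.
   Context: Matroids are on finite ground sets, given by rank functions. The closure of $A\subseteq S$ in a matroid $(S,r)$ is $\mathrm{cl}(A)=\{s\in S:r(A\cup\{s\})=r(A)\}$, and a flat is a set $F$ with $\mathrm{cl}(F)=F$. $\mathcal{F}(M)$ is the lattice of flats ordered by inclusion (meet $\cap$, join $\mathrm{cl}(F_1\cup F_2)$). $M_1\cong M_2$ means there is a bijection $\beta:S_1\to S_2$ with $r_2(\beta(A))=r_1(A)$ for all $A\subseteq S_1$. -}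

module Defs where

open import Data.Nat using (ℕ; _≤_; _+_)
open import Data.Nat.Properties using (_≟_)
open import Data.Fin using (Fin)
open import Data.Fin.Subset using (Subset; _∪_; _∩_; ⁅_⁆; ∣_∣; _⊆_)
open import Data.Vec using (tabulate; lookup)
open import Data.Product using (Σ; proj₁)
open import Relation.Binary.PropositionalEquality using (_≡_)
open import Relation.Nullary using (does)
open import Function.Bundles using (_↔_; Inverse)

-- A matroid on the finite ground set S = Fin n, given by its rank function
-- (standard rank axioms; nonnegativity is automatic in ℕ).
record Matroid (n : ℕ) : Set where
  field
    r         : Subset n → ℕ
    r-bounded : ∀ A → r A ≤ ∣ A ∣
    r-mono    : ∀ A B → A ⊆ B → r A ≤ r B
    r-submod  : ∀ A B → r (A ∪ B) + r (A ∩ B) ≤ r A + r B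
open Matroid public

cl : ∀ {n} → Matroid n → Subset n → Subset n
cl M A = tabulate (λ s → does (r M (A ∪ ⁅ s ⁆) ≟ r M A))

IsFlat : ∀ {n} → Matroid n → Subset n → Set
IsFlat M F = cl M F ≡ F

Flat : ∀ {n} → Matroid n → Set
Flat M = Σ (Subset _) (IsFlat M)

set : ∀ {n} (M : Matroid n) → Flat M → Subset n
set M = proj₁

record LatticeIso {n₁ n₂} (M₁ : Matroid n₁) (M₂ : Matroid n₂) : Set where
  field
    to      : Flat M₁ → Flat M₂
    from    : Flat M₂ → Flat M₁
    to-from : ∀ G → set M₂ (to (from G)) ≡ set M₂ G
    from-to : ∀ F → set M₁ (from (to F)) ≡ set M₁ F
    pres-meet : ∀ F G H → set M₁ H ≡ (set M₁ F ∩ set M₁ G)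
              → set M₂ (to H) ≡ (set M₂ (to F) ∩ set M₂ (to G))
    pres-join : ∀ F G H → set M₁ H ≡ cl M₁ (set M₁ F ∪ set M₁ G)
              → set M₂ (to H) ≡ cl M₂ (set M₂ (to F) ∪ set M₂ (to G))
open LatticeIso public

image : ∀ {n₁ n₂} → Fin n₁ ↔ Fin n₂ → Subset n₁ → Subset n₂
image β A = tabulate (λ j → lookup A (Inverse.from β j))

_≅_ : ∀ {n₁ n₂} → Matroid n₁ → Matroid n₂ → Set
_≅_ {n₁} {n₂} M₁ M₂ =
  Σ (Fin n₁ ↔ Fin n₂) (λ β → ∀ A → r M₂ (image β A) ≡ r M₁ A)

{-# OPTIONS --safe #-}
module Submission where

-- Every point s of a matroid has cl{s} equal either to the set of loops, which is the bottom
-- flat, or to an atom of the lattice of flats. So the fibre of s ↦ cl{s} over the bottom flat L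
-- is L itself, over an atom F it is F ∖ L, and over every other flat it is empty. A lattice
-- isomorphism α preserves the bottom and the atoms, and by hypothesis the sizes of flats, so
-- the fibre of M₁ over F and the fibre of M₂ over α(F) have equally many points. Matching
-- them up gives a bijection β of the ground sets with cl{β s} = α(cl{s}). Then β maps every
-- flat F onto α(F), hence commutes with closure, and a bijection commuting with closure
-- preserves rank, because r(A ∪ {s}) is r(A) or r(A) + 1 according as s lies in cl(A) or not.

open import Defs
open import Axiom.UniquenessOfIdentityProofs using (module Decidable⇒UIP)
open import Data.Bool using (Bool; true; false; if_then_else_) renaming (_≟_ to _≟ᵇ_)
open import Data.Fin using (Fin; zero; suc; punchIn) renaming (_≟_ to _≟ᶠ_)
open import Data.Fin.Permutation using (Permutation; _⟨$⟩ʳ_; _⟨$⟩ˡ_; insert; insert-punchIn)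
import Data.Fin.Permutation as Permutation
open import Data.Fin.Subset
open import Data.Fin.Subset.Induction using (⊂-wellFounded)
open import Data.Fin.Subset.Properties
open import Data.Nat using (ℕ; zero; suc; _+_; _<_; _≤_)
open import Data.Nat.Properties
  using ( _≟_; +-suc; +-comm; +-cancelˡ-≡; +-cancelʳ-≡; +-cancelʳ-≤; +-mono-≤; +-monoʳ-≤
        ; m≤m+n; ≤-antisym; ≤∧≢⇒<; n≤0⇒n≡0; <-irrefl; +-0-commutativeMonoid; module ≤-Reasoning)
open import Algebra.Properties.CommutativeMonoid.Sum +-0-commutativeMonoid using (sum; sum-remove)
open import Data.Product using (Σ; ∃-syntax; _×_; _,_; proj₁; proj₂)
open import Data.Sum using (_⊎_; inj₁; inj₂; [_,_]′)
import Data.Sum as Sum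
open import Data.Vec using (_∷_; []; tabulate; here; there)
open import Data.Vec.Properties using (lookup∘tabulate; []=⇒lookup; lookup⇒[]=; ≡-dec)
open import Function using (_∘_)
open import Induction.WellFounded using (module All)
open import Level using (Level)
open import Relation.Binary.Definitions using (DecidableEquality)
open import Relation.Binary.PropositionalEquality
  using (_≡_; refl; sym; trans; cong; cong₂; subst; module ≡-Reasoning)
open import Relation.Nullary using (yes; no; does; ¬_; contradiction)
open import Relation.Nullary.Decidable using (dec-true)
open import Relation.Unary using (Pred; Decidable)

private
  variable
    ℓ : Level
    n n₁ n₂ : ℕ
    M₁ : Matroid n₁
    M₂ : Matroid n₂
    p q : Subset n
    x : Fin n

-- Finite sets

_≟ˢ_ : DecidableEquality (Subset n)
_≟ˢ_ = ≡-dec _≟ᵇ_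

∈-tabulate⁺ : {f : Fin n → Bool} → f x ≡ true → x ∈ tabulate f
∈-tabulate⁺ {x = x} {f} fx = lookup⇒[]= x _ (trans (lookup∘tabulate f x) fx)

∈-tabulate⁻ : {f : Fin n → Bool} → x ∈ tabulate f → f x ≡ true
∈-tabulate⁻ {x = x} {f} x∈ = trans (sym (lookup∘tabulate f x)) ([]=⇒lookup x∈)

∈-tabulate-does⁺ : {P : Pred (Fin n) ℓ} (P? : Decidable P) → P x → x ∈ tabulate (does ∘ P?)
∈-tabulate-does⁺ {x = x} P? px = ∈-tabulate⁺ (dec-true (P? x) px)

∈-tabulate-does⁻ : {P : Pred (Fin n) ℓ} (P? : Decidable P) → x ∈ tabulate (does ∘ P?) → P x
∈-tabulate-does⁻ {x = x} P? x∈ with P? x | ∈-tabulate⁻ {f = does ∘ P?} x∈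
... | yes px | _ = px
... | no _   | ()

∪-⊆ : ∀ {r : Subset n} → p ⊆ r → q ⊆ r → p ∪ q ⊆ r
∪-⊆ {p = p} {q} p⊆r q⊆r x∈ with x∈p∪q⁻ p q x∈
... | inj₁ x∈p = p⊆r x∈p
... | inj₂ x∈q = q⊆r x∈q

∪-mono : ∀ {p′ q′ : Subset n} → p ⊆ p′ → q ⊆ q′ → p ∪ q ⊆ p′ ∪ q′
∪-mono {p′ = p′} {q′} p⊆p′ q⊆q′ = ∪-⊆ (p⊆p∪q q′ ∘ p⊆p′) (q⊆p∪q p′ q′ ∘ q⊆q′)

⁅x⁆⊆ : x ∈ p → ⁅ x ⁆ ⊆ p
⁅x⁆⊆ {x = x} {p} x∈p y∈⁅x⁆ = subst (_∈ p) (sym (x∈⁅y⁆⇒x≡y x y∈⁅x⁆)) x∈p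

p∪⁅x⁆≡p : x ∈ p → p ∪ ⁅ x ⁆ ≡ p
p∪⁅x⁆≡p x∈p = ⊆-antisym (∪-⊆ ⊆-refl (⁅x⁆⊆ x∈p)) (p⊆p∪q _)

p-x∪⁅x⁆≡p : x ∈ p → (p - x) ∪ ⁅ x ⁆ ≡ p
p-x∪⁅x⁆≡p {x = x} {p} x∈p = ⊆-antisym (∪-⊆ (p─q⊆p p ⁅ x ⁆) (⁅x⁆⊆ x∈p)) p⊆
  where
  p⊆ : p ⊆ (p - x) ∪ ⁅ x ⁆
  p⊆ {y} y∈p with y ≟ᶠ x
  ... | yes refl = q⊆p∪q _ _ (x∈⁅x⁆ x)
  ... | no y≢x   = p⊆p∪q _ (x∈p∧x≢y⇒x∈p-y y∈p y≢x)

x∈p─q⇒x∉q : x ∈ p ─ q → x ∉ q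
x∈p─q⇒x∉q {p = _ ∷ _}      {outside ∷ _} (there x∈) (there x∈q) = x∈p─q⇒x∉q x∈ x∈q
x∈p─q⇒x∉q {p = _ ∷ _}      {inside  ∷ _} (there x∈) (there x∈q) = x∈p─q⇒x∉q x∈ x∈q
x∈p─q⇒x∉q {p = inside ∷ _} {outside ∷ _} here       ()

⊈⇒∃∉ : ¬ p ⊆ q → ∃[ x ] x ∈ p × x ∉ q
⊈⇒∃∉ {p = p} {q} p⊈q with nonempty? (p ─ q)
... | yes (x , x∈p─q) = x , p─q⊆p p q x∈p─q , x∈p─q⇒x∉q x∈p─q
... | no p─q-empty    = contradiction (λ {x} → p⊆q {x}) p⊈q
  where
  p⊆q : p ⊆ q
  p⊆q {x} x∈p with x ∈? q
  ... | yes x∈q = x∈q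
  ... | no x∉q  = contradiction (x , x∈p∧x∉q⇒x∈p─q x∈p x∉q) p─q-empty

∪⁅⁆-induction : (P : Subset n → Set ℓ) → P ⊥ → (∀ {p} x → P p → P (p ∪ ⁅ x ⁆)) → ∀ p → P p
∪⁅⁆-induction P P⊥ P∪⁅⁆ = All.wfRec ⊂-wellFounded _ P step
  where
  step : ∀ p → (∀ {q} → q ⊂ p → P q) → P p
  step p rec with nonempty? p
  ... | no p-empty      = subst P (sym (Empty-unique p-empty)) P⊥
  ... | yes (x , x∈p)   = subst P (p-x∪⁅x⁆≡p x∈p) (P∪⁅⁆ x (rec (x∈p⇒p-x⊂p x∈p)))

∣p─q∣+∣q∣≡∣p∣ : q ⊆ p → ∣ p ─ q ∣ + ∣ q ∣ ≡ ∣ p ∣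
∣p─q∣+∣q∣≡∣p∣ {q = []}          {[]}          _   = refl
∣p─q∣+∣q∣≡∣p∣ {q = outside ∷ q} {outside ∷ p} q⊆p = ∣p─q∣+∣q∣≡∣p∣ (drop-∷-⊆ q⊆p)
∣p─q∣+∣q∣≡∣p∣ {q = outside ∷ q} {inside  ∷ p} q⊆p = cong suc (∣p─q∣+∣q∣≡∣p∣ (drop-∷-⊆ q⊆p))
∣p─q∣+∣q∣≡∣p∣ {q = inside  ∷ q} {inside  ∷ p} q⊆p =
  trans (+-suc ∣ p ─ q ∣ ∣ q ∣) (cong suc (∣p─q∣+∣q∣≡∣p∣ (drop-∷-⊆ q⊆p)))
∣p─q∣+∣q∣≡∣p∣ {q = inside  ∷ q} {outside ∷ p} q⊆p with q⊆p here
... | ()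

x∈p⇒0<∣p∣ : x ∈ p → 0 < ∣ p ∣
x∈p⇒0<∣p∣ {x = x} x∈p = subst (_≤ _) (∣⁅x⁆∣≡1 x) (p⊆q⇒∣p∣≤∣q∣ (⁅x⁆⊆ x∈p))

Empty⇒∣p∣≡0 : Empty p → ∣ p ∣ ≡ 0
Empty⇒∣p∣≡0 {n} p-empty = trans (cong ∣_∣ (Empty-unique p-empty)) (∣⊥∣≡0 n)

0<∣p∣⇒Nonempty : 0 < ∣ p ∣ → Nonempty p
0<∣p∣⇒Nonempty {p = p} 0<∣p∣ with nonempty? p
... | yes p-nonempty = p-nonempty
... | no p-empty     = contradiction (Empty⇒∣p∣≡0 p-empty) (λ ∣p∣≡0 → <-irrefl (sym ∣p∣≡0) 0<∣p∣)

∣tabulate∣-remove : ∀ (f : Fin (suc n) → Bool) t →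
                    ∣ tabulate f ∣ ≡ (if f t then 1 else 0) + ∣ tabulate (f ∘ punchIn t) ∣
∣tabulate∣-remove f t = begin
  ∣ tabulate f ∣                                     ≡⟨ ∣tabulate∣≡sum f ⟩
  sum (indicator ∘ f)                               ≡⟨ sum-remove {i = t} (indicator ∘ f) ⟩
  indicator (f t) + sum (indicator ∘ f ∘ punchIn t)  ≡⟨ cong (indicator (f t) +_) ∣f∘punchIn∣≡sum ⟨
  indicator (f t) + ∣ tabulate (f ∘ punchIn t) ∣     ∎
  where
  open ≡-Reasoning
  indicator : Bool → ℕ
  indicator b = if b then 1 else 0
  ∣tabulate∣≡sum : ∀ {m} (g : Fin m → Bool) → ∣ tabulate g ∣ ≡ sum (indicator ∘ g)
  ∣tabulate∣≡sum {zero}  g = refl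
  ∣tabulate∣≡sum {suc m} g with g zero
  ... | true  = cong suc (∣tabulate∣≡sum (g ∘ suc))
  ... | false = ∣tabulate∣≡sum (g ∘ suc)
  ∣f∘punchIn∣≡sum : ∣ tabulate (f ∘ punchIn t) ∣ ≡ sum (indicator ∘ f ∘ punchIn t)
  ∣f∘punchIn∣≡sum = ∣tabulate∣≡sum (f ∘ punchIn t)

-- Fibres of a colouring

module Fibres {C : Set} (_≟_ : DecidableEquality C) where

  fibre : (Fin n → C) → C → Subset n
  fibre f k = tabulate (λ s → does (f s ≟ k))

  ∈-fibre⁺ : ∀ (f : Fin n → C) {k s} → f s ≡ k → s ∈ fibre f k
  ∈-fibre⁺ f {k} = ∈-tabulate-does⁺ (λ s → f s ≟ k)

  ∈-fibre⁻ : ∀ (f : Fin n → C) {k s} → s ∈ fibre f k → f s ≡ k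
  ∈-fibre⁻ f {k} = ∈-tabulate-does⁻ (λ s → f s ≟ k)

  ∣fibre∣≡0 : ∀ {P : Pred C ℓ} (f : Fin n → C) {k} → (∀ s → P (f s)) → ¬ P k → ∣ fibre f k ∣ ≡ 0
  ∣fibre∣≡0 {P = P} f Pf ¬Pk = Empty⇒∣p∣≡0 λ (s , s∈) → ¬Pk (subst P (∈-fibre⁻ f s∈) (Pf s))

  fibre-witness : ∀ (f₁ : Fin n₁ → C) (f₂ : Fin n₂ → C) →
                  (∀ k → ∣ fibre f₁ k ∣ ≡ ∣ fibre f₂ k ∣) → ∀ s → ∃[ t ] f₂ t ≡ f₁ s
  fibre-witness f₁ f₂ ∣f₁∣≡∣f₂∣ s =
    let t , t∈ = 0<∣p∣⇒Nonempty (subst (0 <_) (∣f₁∣≡∣f₂∣ (f₁ s)) (x∈p⇒0<∣p∣ (∈-fibre⁺ f₁ refl)))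
    in  t , ∈-fibre⁻ f₂ t∈

  ∣fibres∣-punchIn : ∀ (f₁ : Fin (suc n₁) → C) (f₂ : Fin (suc n₂) → C) →
                     (∀ k → ∣ fibre f₁ k ∣ ≡ ∣ fibre f₂ k ∣) → ∀ s t → f₂ t ≡ f₁ s →
                     ∀ k → ∣ fibre (f₁ ∘ punchIn s) k ∣ ≡ ∣ fibre (f₂ ∘ punchIn t) k ∣
  ∣fibres∣-punchIn f₁ f₂ ∣f₁∣≡∣f₂∣ s t f₂t≡f₁s k = +-cancelˡ-≡ _ _ _ (begin
    indicator (f₁ s) + ∣ fibre (f₁ ∘ punchIn s) k ∣  ≡⟨ ∣tabulate∣-remove (λ s → does (f₁ s ≟ k)) s ⟨
    ∣ fibre f₁ k ∣                                  ≡⟨ ∣f₁∣≡∣f₂∣ k ⟩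
    ∣ fibre f₂ k ∣                                  ≡⟨ ∣tabulate∣-remove (λ t → does (f₂ t ≟ k)) t ⟩
    indicator (f₂ t) + ∣ fibre (f₂ ∘ punchIn t) k ∣  ≡⟨ cong (λ c → indicator c + _) f₂t≡f₁s ⟩
    indicator (f₁ s) + ∣ fibre (f₂ ∘ punchIn t) k ∣  ∎)
    where
    open ≡-Reasoning
    indicator : C → ℕ
    indicator c = if does (c ≟ k) then 1 else 0

  fibres-permutation : ∀ (f₁ : Fin n₁ → C) (f₂ : Fin n₂ → C) →
                       (∀ k → ∣ fibre f₁ k ∣ ≡ ∣ fibre f₂ k ∣) →
                       Σ (Permutation n₁ n₂) λ β → ∀ s → f₂ (β ⟨$⟩ʳ s) ≡ f₁ s
  fibres-permutation {zero}  {zero}  _  _  _ = Permutation.id , λ ()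
  fibres-permutation {zero}  {suc _} f₁ f₂ ∣f₁∣≡∣f₂∣ with fibre-witness f₂ f₁ (sym ∘ ∣f₁∣≡∣f₂∣) zero
  ... | () , _
  fibres-permutation {suc _} {zero}  f₁ f₂ ∣f₁∣≡∣f₂∣ with fibre-witness f₁ f₂ ∣f₁∣≡∣f₂∣ zero
  ... | () , _
  fibres-permutation {suc _} {suc _} f₁ f₂ ∣f₁∣≡∣f₂∣ with fibre-witness f₁ f₂ ∣f₁∣≡∣f₂∣ zero
  ... | t , f₂t≡f₁0
    with fibres-permutation (f₁ ∘ suc) (f₂ ∘ punchIn t) (∣fibres∣-punchIn f₁ f₂ ∣f₁∣≡∣f₂∣ zero t f₂t≡f₁0)
  ... | β , β-respects = insert zero t β , λ where
    zero    → f₂t≡f₁0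
    (suc s) → trans (cong f₂ (insert-punchIn zero t β s)) (β-respects s)

open module SubsetFibres {m : ℕ} = Fibres (_≟ˢ_ {m})

-- Closure, loops and atoms

module _ (M : Matroid n) where

  private
    variable
      A B X : Subset n
      s t : Fin n

  ∈-cl⁺ : r M (A ∪ ⁅ s ⁆) ≡ r M A → s ∈ cl M A
  ∈-cl⁺ {A} = ∈-tabulate-does⁺ (λ s → r M (A ∪ ⁅ s ⁆) ≟ r M A)

  ∈-cl⁻ : s ∈ cl M A → r M (A ∪ ⁅ s ⁆) ≡ r M A
  ∈-cl⁻ {A = A} = ∈-tabulate-does⁻ (λ s → r M (A ∪ ⁅ s ⁆) ≟ r M A)

  r-⊥ : r M ⊥ ≡ 0
  r-⊥ = n≤0⇒n≡0 (subst (r M ⊥ ≤_) (∣⊥∣≡0 n) (r-bounded M ⊥))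

  r-∪⁅⁆≤1+r : r M (A ∪ ⁅ s ⁆) ≤ suc (r M A)
  r-∪⁅⁆≤1+r {A} {s} = begin
    r M (A ∪ ⁅ s ⁆)                    ≤⟨ m≤m+n _ _ ⟩
    r M (A ∪ ⁅ s ⁆) + r M (A ∩ ⁅ s ⁆)  ≤⟨ r-submod M A ⁅ s ⁆ ⟩
    r M A + r M ⁅ s ⁆                  ≤⟨ +-monoʳ-≤ (r M A) r⁅s⁆≤1 ⟩
    r M A + 1                          ≡⟨ +-comm (r M A) 1 ⟩
    suc (r M A)                        ∎
    where
    open ≤-Reasoning
    r⁅s⁆≤1 : r M ⁅ s ⁆ ≤ 1
    r⁅s⁆≤1 = subst (r M ⁅ s ⁆ ≤_) (∣⁅x⁆∣≡1 s) (r-bounded M ⁅ s ⁆)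

  ∉-cl⇒r-∪⁅⁆≡1+r : s ∉ cl M A → r M (A ∪ ⁅ s ⁆) ≡ suc (r M A)
  ∉-cl⇒r-∪⁅⁆≡1+r s∉clA = ≤-antisym r-∪⁅⁆≤1+r (≤∧≢⇒< (r-mono M _ _ (p⊆p∪q _)) (s∉clA ∘ ∈-cl⁺ ∘ sym))

  ⊆-cl : A ⊆ cl M A
  ⊆-cl x∈A = ∈-cl⁺ (cong (r M) (p∪⁅x⁆≡p x∈A))

  cl-mono : A ⊆ B → cl M A ⊆ cl M B
  cl-mono {A} {B} A⊆B {s} s∈clA = ∈-cl⁺ (≤-antisym r[B∪s]≤r[B] (r-mono M _ _ (p⊆p∪q _)))
    where
    open ≤-Reasoning
    r[B∪s]≤r[B] : r M (B ∪ ⁅ s ⁆) ≤ r M B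
    r[B∪s]≤r[B] = +-cancelʳ-≤ (r M A) _ _ (begin
      r M (B ∪ ⁅ s ⁆) + r M A
        ≤⟨ +-mono-≤ (r-mono M _ _ (∪-mono ⊆-refl (q⊆p∪q A _)))
                    (r-mono M _ _ λ x∈A → x∈p∩q⁺ (A⊆B x∈A , p⊆p∪q _ x∈A)) ⟩
      r M (B ∪ (A ∪ ⁅ s ⁆)) + r M (B ∩ (A ∪ ⁅ s ⁆))  ≤⟨ r-submod M B (A ∪ ⁅ s ⁆) ⟩
      r M B + r M (A ∪ ⁅ s ⁆)                        ≡⟨ cong (r M B +_) (∈-cl⁻ s∈clA) ⟩
      r M B + r M A                                  ∎)

  r≡⇒cl≡ : A ⊆ B → r M B ≡ r M A → cl M B ≡ cl M A
  r≡⇒cl≡ {A} {B} A⊆B rB≡rA = ⊆-antisym clB⊆clA (cl-mono A⊆B)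
    where
    open ≤-Reasoning
    clB⊆clA : cl M B ⊆ cl M A
    clB⊆clA {s} s∈clB = ∈-cl⁺ (≤-antisym (begin
      r M (A ∪ ⁅ s ⁆)  ≤⟨ r-mono M _ _ (∪-mono A⊆B ⊆-refl) ⟩
      r M (B ∪ ⁅ s ⁆)  ≡⟨ ∈-cl⁻ s∈clB ⟩
      r M B            ≡⟨ rB≡rA ⟩
      r M A            ∎) (r-mono M _ _ (p⊆p∪q _)))

  r-∪-⊆cl : X ⊆ cl M A → r M (A ∪ X) ≡ r M A
  r-∪-⊆cl {X} {A} = ∪⁅⁆-induction (λ X → X ⊆ cl M A → r M (A ∪ X) ≡ r M A)
                                  (λ _ → cong (r M) (∪-identityʳ A)) step X
    where
    open ≡-Reasoning
    step : ∀ {X} x → (X ⊆ cl M A → r M (A ∪ X) ≡ r M A) →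
           X ∪ ⁅ x ⁆ ⊆ cl M A → r M (A ∪ (X ∪ ⁅ x ⁆)) ≡ r M A
    step {X} x ih X∪x⊆clA = begin
      r M (A ∪ (X ∪ ⁅ x ⁆))  ≡⟨ cong (r M) (∪-assoc A X ⁅ x ⁆) ⟨
      r M ((A ∪ X) ∪ ⁅ x ⁆)  ≡⟨ ∈-cl⁻ (cl-mono (p⊆p∪q X) (X∪x⊆clA (q⊆p∪q X _ (x∈⁅x⁆ x)))) ⟩
      r M (A ∪ X)            ≡⟨ ih (⊆-trans (p⊆p∪q _) X∪x⊆clA) ⟩
      r M A                  ∎

  cl-idem : ∀ A → cl M (cl M A) ≡ cl M A
  cl-idem A = r≡⇒cl≡ ⊆-cl (begin
    r M (cl M A)      ≡⟨ cong (r M) (⊆-antisym (∪-⊆ ⊆-cl ⊆-refl) (q⊆p∪q A _)) ⟨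
    r M (A ∪ cl M A)  ≡⟨ r-∪-⊆cl ⊆-refl ⟩
    r M A             ∎)
    where open ≡-Reasoning

  closure : Subset n → Flat M
  closure A = cl M A , cl-idem A

  cl-least : IsFlat M B → A ⊆ B → cl M A ⊆ B
  cl-least B-flat A⊆B = ⊆-trans (cl-mono A⊆B) (⊆-reflexive B-flat)

  Flat-≡ : ∀ {F G : Flat M} → set M F ≡ set M G → F ≡ G
  Flat-≡ {F , F-flat} {.F , G-flat} refl = cong (F ,_) (≡-irrelevant F-flat G-flat)
    where open Decidable⇒UIP _≟ˢ_

  loops : Subset n
  loops = cl M ⊥

  loops⊆ : ∀ F → loops ⊆ set M F
  loops⊆ (F , F-flat) = cl-least F-flat ⊥⊆

  cl⁅loop⁆≡loops : s ∈ loops → cl M ⁅ s ⁆ ≡ loops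
  cl⁅loop⁆≡loops {s} s∈L = r≡⇒cl≡ ⊥⊆ (trans (cong (r M) (sym (∪-identityˡ ⁅ s ⁆))) (∈-cl⁻ s∈L))

  r⁅nonloop⁆≡1 : s ∉ loops → r M ⁅ s ⁆ ≡ 1
  r⁅nonloop⁆≡1 {s} s∉L = begin
    r M ⁅ s ⁆        ≡⟨ cong (r M) (∪-identityˡ ⁅ s ⁆) ⟨
    r M (⊥ ∪ ⁅ s ⁆)  ≡⟨ ∉-cl⇒r-∪⁅⁆≡1+r s∉L ⟩
    suc (r M ⊥)      ≡⟨ cong suc r-⊥ ⟩
    1                ∎
    where open ≡-Reasoning

  cl⁅⁆-exchange : s ∉ loops → t ∉ loops → t ∈ cl M ⁅ s ⁆ → cl M ⁅ t ⁆ ≡ cl M ⁅ s ⁆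
  cl⁅⁆-exchange {s} {t} s∉L t∉L t∈cl⁅s⁆ = trans (sym cl⁅st⁆≡cl⁅t⁆) cl⁅st⁆≡cl⁅s⁆
    where
    r⁅st⁆≡r⁅s⁆ : r M (⁅ s ⁆ ∪ ⁅ t ⁆) ≡ r M ⁅ s ⁆
    r⁅st⁆≡r⁅s⁆ = ∈-cl⁻ t∈cl⁅s⁆
    cl⁅st⁆≡cl⁅s⁆ : cl M (⁅ s ⁆ ∪ ⁅ t ⁆) ≡ cl M ⁅ s ⁆
    cl⁅st⁆≡cl⁅s⁆ = r≡⇒cl≡ (p⊆p∪q _) r⁅st⁆≡r⁅s⁆
    cl⁅st⁆≡cl⁅t⁆ : cl M (⁅ s ⁆ ∪ ⁅ t ⁆) ≡ cl M ⁅ t ⁆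
    cl⁅st⁆≡cl⁅t⁆ = r≡⇒cl≡ (q⊆p∪q _ _)
                          (trans r⁅st⁆≡r⁅s⁆ (trans (r⁅nonloop⁆≡1 s∉L) (sym (r⁅nonloop⁆≡1 t∉L))))

  -- Stated for the poset of flats alone, so that order isomorphisms preserve them.
  IsBottom : Flat M → Set
  IsBottom F = ∀ G → set M F ⊆ set M G

  IsAtom : Flat M → Set
  IsAtom F = ¬ IsBottom F × (∀ G → set M G ⊆ set M F → ¬ IsBottom G → set M F ⊆ set M G)

  loops-bottom : IsBottom (closure ⊥)
  loops-bottom = loops⊆

  bottom⇒≡loops : ∀ F → IsBottom F → set M F ≡ loops
  bottom⇒≡loops F F-bottom = ⊆-antisym (F-bottom (closure ⊥)) (loops⊆ F)

  ⊆loops⇒bottom : ∀ F → set M F ⊆ loops → IsBottom F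
  ⊆loops⇒bottom _ F⊆L G = ⊆-trans F⊆L (loops⊆ G)

  cl⁅nonloop⁆-atom : s ∉ loops → IsAtom (closure ⁅ s ⁆)
  cl⁅nonloop⁆-atom {s} s∉L = nonbottom , minimal
    where
    nonbottom : ¬ IsBottom (closure ⁅ s ⁆)
    nonbottom bottom = s∉L (bottom (closure ⊥) (⊆-cl (x∈⁅x⁆ s)))
    minimal : ∀ G → set M G ⊆ cl M ⁅ s ⁆ → ¬ IsBottom G → cl M ⁅ s ⁆ ⊆ set M G
    minimal (G , G-flat) G⊆cl⁅s⁆ G-nonbottom =
      let t , t∈G , t∉L = ⊈⇒∃∉ (G-nonbottom ∘ ⊆loops⇒bottom (G , G-flat))
      in  ⊆-trans (⊆-reflexive (sym (cl⁅⁆-exchange s∉L t∉L (G⊆cl⁅s⁆ t∈G))))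
                  (cl-least G-flat (⁅x⁆⊆ t∈G))

  fibre-loops : fibre (cl M ∘ ⁅_⁆) loops ≡ loops
  fibre-loops = ⊆-antisym (λ {s} s∈ → subst (s ∈_) (∈-fibre⁻ (cl M ∘ ⁅_⁆) s∈) (⊆-cl (x∈⁅x⁆ s)))
                          (∈-fibre⁺ (cl M ∘ ⁅_⁆) ∘ cl⁅loop⁆≡loops)

  fibre-atom : ∀ F → IsAtom F → fibre (cl M ∘ ⁅_⁆) (set M F) ≡ set M F ─ loops
  fibre-atom (F , F-flat) (F-nonbottom , F-minimal) = ⊆-antisym fibre⊆ ⊆fibre
    where
    fibre⊆ : fibre (cl M ∘ ⁅_⁆) F ⊆ F ─ loops
    fibre⊆ {s} s∈ = x∈p∧x∉q⇒x∈p─q (subst (s ∈_) cl⁅s⁆≡F (⊆-cl (x∈⁅x⁆ s))) s∉L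
      where
      cl⁅s⁆≡F : cl M ⁅ s ⁆ ≡ F
      cl⁅s⁆≡F = ∈-fibre⁻ (cl M ∘ ⁅_⁆) s∈
      s∉L : s ∉ loops
      s∉L s∈L = F-nonbottom (⊆loops⇒bottom (F , F-flat)
                                           (⊆-reflexive (trans (sym cl⁅s⁆≡F) (cl⁅loop⁆≡loops s∈L))))
    ⊆fibre : F ─ loops ⊆ fibre (cl M ∘ ⁅_⁆) F
    ⊆fibre {s} s∈ = ∈-fibre⁺ (cl M ∘ ⁅_⁆) (⊆-antisym cl⁅s⁆⊆F
                      (F-minimal (closure ⁅ s ⁆) cl⁅s⁆⊆F (proj₁ (cl⁅nonloop⁆-atom (x∈p─q⇒x∉q s∈)))))
      where
      cl⁅s⁆⊆F : cl M ⁅ s ⁆ ⊆ F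
      cl⁅s⁆⊆F = cl-least F-flat (⁅x⁆⊆ (p─q⊆p F loops s∈))

  ∣fibre∣-bottom : ∀ F → IsBottom F → ∣ fibre (cl M ∘ ⁅_⁆) (set M F) ∣ ≡ ∣ set M F ∣
  ∣fibre∣-bottom F F-bottom rewrite bottom⇒≡loops F F-bottom = cong ∣_∣ fibre-loops

  ∣fibre∣-atom : ∀ F → IsAtom F → ∣ fibre (cl M ∘ ⁅_⁆) (set M F) ∣ + ∣ loops ∣ ≡ ∣ set M F ∣
  ∣fibre∣-atom F F-atom =
    trans (cong (λ p → ∣ p ∣ + ∣ loops ∣) (fibre-atom F F-atom)) (∣p─q∣+∣q∣≡∣p∣ (loops⊆ F))

  nonempty-fibre⇒bottom⊎atom : ∀ F → Nonempty (fibre (cl M ∘ ⁅_⁆) (set M F)) → IsBottom F ⊎ IsAtom F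
  nonempty-fibre⇒bottom⊎atom F (s , s∈) with s ∈? loops
  ... | yes s∈L = inj₁ (⊆loops⇒bottom F (⊆-reflexive (trans (sym cl⁅s⁆≡F) (cl⁅loop⁆≡loops s∈L))))
    where
    cl⁅s⁆≡F : cl M ⁅ s ⁆ ≡ set M F
    cl⁅s⁆≡F = ∈-fibre⁻ (cl M ∘ ⁅_⁆) s∈
  ... | no s∉L  = inj₂ (subst IsAtom (Flat-≡ {closure ⁅ s ⁆} {F} (∈-fibre⁻ (cl M ∘ ⁅_⁆) s∈))
                                     (cl⁅nonloop⁆-atom s∉L))

-- Bijections of the ground sets

module _ (β : Permutation n₁ n₂) where

  private
    variable
      A B : Subset n₁
      s : Fin n₁
      t : Fin n₂

  ∈-image⁺ : β ⟨$⟩ˡ t ∈ A → t ∈ image β A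
  ∈-image⁺ = ∈-tabulate⁺ ∘ []=⇒lookup

  ∈-image⁻ : t ∈ image β A → β ⟨$⟩ˡ t ∈ A
  ∈-image⁻ = lookup⇒[]= _ _ ∘ ∈-tabulate⁻

  β∈-image⁺ : s ∈ A → β ⟨$⟩ʳ s ∈ image β A
  β∈-image⁺ {A = A} s∈A = ∈-image⁺ (subst (_∈ A) (sym (Permutation.inverseˡ β)) s∈A)

  β∈-image⁻ : β ⟨$⟩ʳ s ∈ image β A → s ∈ A
  β∈-image⁻ {A = A} βs∈ = subst (_∈ A) (Permutation.inverseˡ β) (∈-image⁻ βs∈)

  image-mono : A ⊆ B → image β A ⊆ image β B
  image-mono A⊆B = ∈-image⁺ ∘ A⊆B ∘ ∈-image⁻

  image-reflects-⊆ : image β A ⊆ image β B → A ⊆ B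
  image-reflects-⊆ βA⊆βB = β∈-image⁻ ∘ βA⊆βB ∘ β∈-image⁺

  image-⊥ : image β ⊥ ≡ ⊥
  image-⊥ = Empty-unique λ (_ , t∈) → ∉⊥ (∈-image⁻ t∈)

  image-∪⁅⁆ : ∀ A s → image β (A ∪ ⁅ s ⁆) ≡ image β A ∪ ⁅ β ⟨$⟩ʳ s ⁆
  image-∪⁅⁆ A s = ⊆-antisym ⊆∪ ∪⊆
    where
    ⊆∪ : image β (A ∪ ⁅ s ⁆) ⊆ image β A ∪ ⁅ β ⟨$⟩ʳ s ⁆
    ⊆∪ {t} t∈ with x∈p∪q⁻ A ⁅ s ⁆ (∈-image⁻ t∈)
    ... | inj₁ β⁻¹t∈A   = p⊆p∪q _ (∈-image⁺ β⁻¹t∈A)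
    ... | inj₂ β⁻¹t∈⁅s⁆ = q⊆p∪q _ _ (subst (_∈ ⁅ β ⟨$⟩ʳ s ⁆) βs≡t (x∈⁅x⁆ _))
      where
      βs≡t : β ⟨$⟩ʳ s ≡ t
      βs≡t = trans (cong (β ⟨$⟩ʳ_) (sym (x∈⁅y⁆⇒x≡y s β⁻¹t∈⁅s⁆))) (Permutation.inverseʳ β)
    ∪⊆ : image β A ∪ ⁅ β ⟨$⟩ʳ s ⁆ ⊆ image β (A ∪ ⁅ s ⁆)
    ∪⊆ {t} t∈ with x∈p∪q⁻ (image β A) _ t∈
    ... | inj₁ t∈βA   = image-mono {B = A ∪ ⁅ s ⁆} (p⊆p∪q _) t∈βA
    ... | inj₂ t∈⁅βs⁆ = subst (_∈ image β (A ∪ ⁅ s ⁆)) (sym (x∈⁅y⁆⇒x≡y _ t∈⁅βs⁆))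
                              (β∈-image⁺ (q⊆p∪q A _ (x∈⁅x⁆ s)))

cl-image⇒r-image : ∀ (M₁ : Matroid n₁) (M₂ : Matroid n₂) (β : Permutation n₁ n₂) →
                   (∀ A → cl M₂ (image β A) ≡ image β (cl M₁ A)) →
                   ∀ A → r M₂ (image β A) ≡ r M₁ A
cl-image⇒r-image M₁ M₂ β cl-image = ∪⁅⁆-induction _ base step
  where
  open ≡-Reasoning
  base : r M₂ (image β ⊥) ≡ r M₁ ⊥
  base = trans (cong (r M₂) (image-⊥ β)) (trans (r-⊥ M₂) (sym (r-⊥ M₁)))
  β∈cl⁺ : ∀ {A s} → s ∈ cl M₁ A → β ⟨$⟩ʳ s ∈ cl M₂ (image β A)
  β∈cl⁺ {A} = subst (_ ∈_) (sym (cl-image A)) ∘ β∈-image⁺ β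
  β∈cl⁻ : ∀ {A s} → β ⟨$⟩ʳ s ∈ cl M₂ (image β A) → s ∈ cl M₁ A
  β∈cl⁻ {A} = β∈-image⁻ β ∘ subst (_ ∈_) (cl-image A)
  step : ∀ {A} s → r M₂ (image β A) ≡ r M₁ A → r M₂ (image β (A ∪ ⁅ s ⁆)) ≡ r M₁ (A ∪ ⁅ s ⁆)
  step {A} s ih with s ∈? cl M₁ A
  ... | yes s∈clA = begin
    r M₂ (image β (A ∪ ⁅ s ⁆))       ≡⟨ cong (r M₂) (image-∪⁅⁆ β A s) ⟩
    r M₂ (image β A ∪ ⁅ β ⟨$⟩ʳ s ⁆)  ≡⟨ ∈-cl⁻ M₂ (β∈cl⁺ s∈clA) ⟩
    r M₂ (image β A)                 ≡⟨ ih ⟩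
    r M₁ A                           ≡⟨ ∈-cl⁻ M₁ s∈clA ⟨
    r M₁ (A ∪ ⁅ s ⁆)                 ∎
  ... | no s∉clA = begin
    r M₂ (image β (A ∪ ⁅ s ⁆))       ≡⟨ cong (r M₂) (image-∪⁅⁆ β A s) ⟩
    r M₂ (image β A ∪ ⁅ β ⟨$⟩ʳ s ⁆)  ≡⟨ ∉-cl⇒r-∪⁅⁆≡1+r M₂ (s∉clA ∘ β∈cl⁻) ⟩
    suc (r M₂ (image β A))           ≡⟨ cong suc ih ⟩
    suc (r M₁ A)                     ≡⟨ ∉-cl⇒r-∪⁅⁆≡1+r M₁ s∉clA ⟨
    r M₁ (A ∪ ⁅ s ⁆)                 ∎

-- Isomorphisms of the posets of flats

record OrderIso (M₁ : Matroid n₁) (M₂ : Matroid n₂) : Set where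
  field
    to        : Flat M₁ → Flat M₂
    from      : Flat M₂ → Flat M₁
    to-from   : ∀ G → set M₂ (to (from G)) ≡ set M₂ G
    from-to   : ∀ F → set M₁ (from (to F)) ≡ set M₁ F
    to-mono   : ∀ {F G} → set M₁ F ⊆ set M₁ G → set M₂ (to F) ⊆ set M₂ (to G)
    from-mono : ∀ {F G} → set M₂ F ⊆ set M₂ G → set M₁ (from F) ⊆ set M₁ (from G)
open OrderIso public

inverse : OrderIso M₁ M₂ → OrderIso M₂ M₁
inverse φ = record
  { to      = from φ    ; from      = to φ
  ; to-from = from-to φ ; from-to   = to-from φ
  ; to-mono = from-mono φ ; from-mono = to-mono φ
  }

latticeIso⇒orderIso : LatticeIso M₁ M₂ → OrderIso M₁ M₂
latticeIso⇒orderIso {M₁ = M₁} {M₂ = M₂} α = record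
  { to      = to α      ; from      = from α
  ; to-from = to-from α ; from-to   = from-to α
  ; to-mono = meet⇒mono ; from-mono = join⇒mono
  }
  where
  meet⇒mono : ∀ {F G} → set M₁ F ⊆ set M₁ G → set M₂ (to α F) ⊆ set M₂ (to α G)
  meet⇒mono {F} {G} F⊆G = ⊆-trans (⊆-reflexive (pres-meet α F G F F≡F∩G)) (p∩q⊆q _ _)
    where
    F≡F∩G : set M₁ F ≡ set M₁ F ∩ set M₁ G
    F≡F∩G = ⊆-antisym (λ x∈F → x∈p∩q⁺ (x∈F , F⊆G x∈F)) (p∩q⊆p _ _)
  join⇒mono : ∀ {G G′} → set M₂ G ⊆ set M₂ G′ → set M₁ (from α G) ⊆ set M₁ (from α G′)
  join⇒mono {G} {G′} G⊆G′ = ⊆-trans (⊆-trans (p⊆p∪q _) (⊆-cl M₁)) (⊆-reflexive join≡fromG′)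
    where
    join : Flat M₁
    join = closure M₁ (set M₁ (from α G) ∪ set M₁ (from α G′))
    to-join≡G′ : set M₂ (to α join) ≡ set M₂ G′
    to-join≡G′ = begin
      set M₂ (to α join)
        ≡⟨ pres-join α (from α G) (from α G′) join refl ⟩
      cl M₂ (set M₂ (to α (from α G)) ∪ set M₂ (to α (from α G′)))
        ≡⟨ cong₂ (λ p q → cl M₂ (p ∪ q)) (to-from α G) (to-from α G′) ⟩
      cl M₂ (set M₂ G ∪ set M₂ G′)
        ≡⟨ cong (cl M₂) (⊆-antisym (∪-⊆ G⊆G′ ⊆-refl) (q⊆p∪q _ _)) ⟩
      cl M₂ (set M₂ G′)
        ≡⟨ proj₂ G′ ⟩
      set M₂ G′
        ∎
      where open ≡-Reasoning
    join≡fromG′ : set M₁ join ≡ set M₁ (from α G′)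
    join≡fromG′ = trans (sym (from-to α join)) (cong (set M₁ ∘ from α) (Flat-≡ M₂ to-join≡G′))

to-reflects-⊆ : ∀ (φ : OrderIso M₁ M₂) {F G} → set M₂ (to φ F) ⊆ set M₂ (to φ G) → set M₁ F ⊆ set M₁ G
to-reflects-⊆ φ {F} {G} toF⊆toG =
  ⊆-trans (⊆-reflexive (sym (from-to φ F))) (⊆-trans (from-mono φ toF⊆toG) (⊆-reflexive (from-to φ G)))

from≡⇒≡to : ∀ (φ : OrderIso M₁ M₂) {G F} → set M₁ (from φ G) ≡ set M₁ F → set M₂ G ≡ set M₂ (to φ F)
from≡⇒≡to {M₁ = M₁} {M₂ = M₂} φ {G} e = trans (sym (to-from φ G)) (cong (set M₂ ∘ to φ) (Flat-≡ M₁ e))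

≡to⇒from≡ : ∀ (φ : OrderIso M₁ M₂) {G F} → set M₂ G ≡ set M₂ (to φ F) → set M₁ (from φ G) ≡ set M₁ F
≡to⇒from≡ {M₁ = M₁} {M₂ = M₂} φ {F = F} e = trans (cong (set M₁ ∘ from φ) (Flat-≡ M₂ e)) (from-to φ F)

preserves-bottom : ∀ (φ : OrderIso M₁ M₂) F → IsBottom M₁ F → IsBottom M₂ (to φ F)
preserves-bottom φ F F-bottom G = ⊆-trans (to-mono φ (F-bottom (from φ G))) (⊆-reflexive (to-from φ G))

reflects-bottom : ∀ (φ : OrderIso M₁ M₂) G → IsBottom M₁ (from φ G) → IsBottom M₂ G
reflects-bottom φ G fromG-bottom H =
  ⊆-trans (⊆-reflexive (sym (to-from φ G))) (preserves-bottom φ (from φ G) fromG-bottom H)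

preserves-atom : ∀ (φ : OrderIso M₁ M₂) F → IsAtom M₁ F → IsAtom M₂ (to φ F)
preserves-atom {M₁ = M₁} {M₂ = M₂} φ F (F-nonbottom , F-minimal) =
  F-nonbottom ∘ reflects-bottom (inverse φ) F , toF-minimal
  where
  toF-minimal : ∀ G → set M₂ G ⊆ set M₂ (to φ F) → ¬ IsBottom M₂ G → set M₂ (to φ F) ⊆ set M₂ G
  toF-minimal G G⊆toF G-nonbottom =
    ⊆-trans (to-mono φ (F-minimal (from φ G) (⊆-trans (from-mono φ G⊆toF) (⊆-reflexive (from-to φ F)))
                                  (G-nonbottom ∘ reflects-bottom φ G)))
            (⊆-reflexive (to-from φ G))

reflects-bottom⊎atom : ∀ (φ : OrderIso M₁ M₂) F →
                       IsBottom M₂ (to φ F) ⊎ IsAtom M₂ (to φ F) → IsBottom M₁ F ⊎ IsAtom M₁ F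
reflects-bottom⊎atom {M₁ = M₁} φ F =
  subst (λ F′ → IsBottom M₁ F′ ⊎ IsAtom M₁ F′) (Flat-≡ M₁ {from φ (to φ F)} {F} (from-to φ F))
  ∘ Sum.map (preserves-bottom (inverse φ) (to φ F)) (preserves-atom (inverse φ) (to φ F))

module _ {M₁ : Matroid n₁} {M₂ : Matroid n₂}
         (φ : OrderIso M₁ M₂) (∣φ∣ : ∀ F → ∣ set M₂ (to φ F) ∣ ≡ ∣ set M₁ F ∣) where

  ∣loops∣-preserved : ∣ loops M₂ ∣ ≡ ∣ loops M₁ ∣
  ∣loops∣-preserved = begin
    ∣ loops M₂ ∣          ≡⟨ cong ∣_∣ (bottom⇒≡loops M₂ (to φ L₁) toL₁-bottom) ⟨
    ∣ set M₂ (to φ L₁) ∣  ≡⟨ ∣φ∣ L₁ ⟩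
    ∣ loops M₁ ∣          ∎
    where
    open ≡-Reasoning
    L₁ : Flat M₁
    L₁ = closure M₁ ⊥
    toL₁-bottom : IsBottom M₂ (to φ L₁)
    toL₁-bottom = preserves-bottom φ L₁ (loops-bottom M₁)

  ∣fibre∣-preserved-bottom : ∀ F → IsBottom M₁ F →
                             ∣ fibre (cl M₁ ∘ ⁅_⁆) (set M₁ F) ∣ ≡
                             ∣ fibre (cl M₂ ∘ ⁅_⁆) (set M₂ (to φ F)) ∣
  ∣fibre∣-preserved-bottom F F-bottom = begin
    ∣ fibre (cl M₁ ∘ ⁅_⁆) (set M₁ F) ∣        ≡⟨ ∣fibre∣-bottom M₁ F F-bottom ⟩
    ∣ set M₁ F ∣                              ≡⟨ ∣φ∣ F ⟨
    ∣ set M₂ (to φ F) ∣                       ≡⟨ ∣fibre∣-bottom M₂ (to φ F) toF-bottom ⟨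
    ∣ fibre (cl M₂ ∘ ⁅_⁆) (set M₂ (to φ F)) ∣  ∎
    where
    open ≡-Reasoning
    toF-bottom : IsBottom M₂ (to φ F)
    toF-bottom = preserves-bottom φ F F-bottom

  ∣fibre∣-preserved-atom : ∀ F → IsAtom M₁ F →
                           ∣ fibre (cl M₁ ∘ ⁅_⁆) (set M₁ F) ∣ ≡
                           ∣ fibre (cl M₂ ∘ ⁅_⁆) (set M₂ (to φ F)) ∣
  ∣fibre∣-preserved-atom F F-atom = +-cancelʳ-≡ ∣ loops M₁ ∣ _ _ (begin
    ∣ fibre (cl M₁ ∘ ⁅_⁆) (set M₁ F) ∣ + ∣ loops M₁ ∣         ≡⟨ ∣fibre∣-atom M₁ F F-atom ⟩
    ∣ set M₁ F ∣                                              ≡⟨ ∣φ∣ F ⟨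
    ∣ set M₂ (to φ F) ∣                                       ≡⟨ ∣fibre∣-atom M₂ (to φ F) toF-atom ⟨
    ∣ fibre (cl M₂ ∘ ⁅_⁆) (set M₂ (to φ F)) ∣ + ∣ loops M₂ ∣  ≡⟨ cong (_ +_) ∣loops∣-preserved ⟩
    ∣ fibre (cl M₂ ∘ ⁅_⁆) (set M₂ (to φ F)) ∣ + ∣ loops M₁ ∣  ∎)
    where
    open ≡-Reasoning
    toF-atom : IsAtom M₂ (to φ F)
    toF-atom = preserves-atom φ F F-atom

  ∣fibre∣-preserved-bottom⊎atom : ∀ F → IsBottom M₁ F ⊎ IsAtom M₁ F →
                                  ∣ fibre (cl M₁ ∘ ⁅_⁆) (set M₁ F) ∣ ≡
                                  ∣ fibre (cl M₂ ∘ ⁅_⁆) (set M₂ (to φ F)) ∣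
  ∣fibre∣-preserved-bottom⊎atom F = [ ∣fibre∣-preserved-bottom F , ∣fibre∣-preserved-atom F ]′

  ∣fibre∣-preserved : ∀ F → ∣ fibre (cl M₁ ∘ ⁅_⁆) (set M₁ F) ∣ ≡
                            ∣ fibre (cl M₂ ∘ ⁅_⁆) (set M₂ (to φ F)) ∣
  ∣fibre∣-preserved F with nonempty? (fibre (cl M₁ ∘ ⁅_⁆) (set M₁ F))
                         | nonempty? (fibre (cl M₂ ∘ ⁅_⁆) (set M₂ (to φ F)))
  ... | yes nonempty₁ | _ =
    ∣fibre∣-preserved-bottom⊎atom F (nonempty-fibre⇒bottom⊎atom M₁ F nonempty₁)
  ... | no _ | yes nonempty₂ =
    ∣fibre∣-preserved-bottom⊎atom F
      (reflects-bottom⊎atom φ F (nonempty-fibre⇒bottom⊎atom M₂ (to φ F) nonempty₂))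
  ... | no empty₁ | no empty₂ = trans (Empty⇒∣p∣≡0 empty₁) (sym (Empty⇒∣p∣≡0 empty₂))

  -- A point t of M₂ is coloured by the flat of M₁ that φ matches with cl{t}.
  point-permutation : Σ (Permutation n₁ n₂) λ β →
                      ∀ s → cl M₂ ⁅ β ⟨$⟩ʳ s ⁆ ≡ set M₂ (to φ (closure M₁ ⁅ s ⁆))
  point-permutation =
    let β , β-respects = fibres-permutation (cl M₁ ∘ ⁅_⁆) colour₂ ∣fibres∣-equal
    in  β , λ s → from≡⇒≡to φ (β-respects s)
    where
    colour₂ : Fin n₂ → Subset n₁
    colour₂ t = set M₁ (from φ (closure M₂ ⁅ t ⁆))
    fibre-colour₂ : ∀ F → fibre colour₂ (set M₁ F) ≡ fibre (cl M₂ ∘ ⁅_⁆) (set M₂ (to φ F))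
    fibre-colour₂ F = ⊆-antisym (∈-fibre⁺ (cl M₂ ∘ ⁅_⁆) ∘ from≡⇒≡to φ ∘ ∈-fibre⁻ colour₂)
                                (∈-fibre⁺ colour₂ ∘ ≡to⇒from≡ φ ∘ ∈-fibre⁻ (cl M₂ ∘ ⁅_⁆))
    ∣fibres∣-equal : ∀ k → ∣ fibre (cl M₁ ∘ ⁅_⁆) k ∣ ≡ ∣ fibre colour₂ k ∣
    ∣fibres∣-equal k with cl M₁ k ≟ˢ k
    ... | yes k-flat   = trans (∣fibre∣-preserved (k , k-flat))
                               (cong ∣_∣ (sym (fibre-colour₂ (k , k-flat))))
    ... | no k-nonflat = trans (∣fibre∣≡0 (cl M₁ ∘ ⁅_⁆) (λ s → cl-idem M₁ ⁅ s ⁆) k-nonflat)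
                               (sym (∣fibre∣≡0 colour₂ (λ t → proj₂ (from φ (closure M₂ ⁅ t ⁆))) k-nonflat))

module _ {M₁ : Matroid n₁} {M₂ : Matroid n₂} (φ : OrderIso M₁ M₂) (β : Permutation n₁ n₂)
         (β-points : ∀ s → cl M₂ ⁅ β ⟨$⟩ʳ s ⁆ ≡ set M₂ (to φ (closure M₁ ⁅ s ⁆))) where

  image-flat : ∀ F → image β (set M₁ F) ≡ set M₂ (to φ F)
  image-flat F = ⊆-antisym
    (λ t∈ → subst (_∈ set M₂ (to φ F)) (Permutation.inverseʳ β) (β∈to⁺ (∈-image⁻ β t∈)))
    (λ t∈ → ∈-image⁺ β (β∈to⁻ (subst (_∈ set M₂ (to φ F)) (sym (Permutation.inverseʳ β)) t∈)))
    where
    β∈to⁺ : ∀ {s} → s ∈ set M₁ F → β ⟨$⟩ʳ s ∈ set M₂ (to φ F)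
    β∈to⁺ {s} s∈F = subst (_⊆ set M₂ (to φ F)) (sym (β-points s))
                          (to-mono φ (cl-least M₁ (proj₂ F) (⁅x⁆⊆ s∈F)))
                          (⊆-cl M₂ (x∈⁅x⁆ _))
    β∈to⁻ : ∀ {s} → β ⟨$⟩ʳ s ∈ set M₂ (to φ F) → s ∈ set M₁ F
    β∈to⁻ {s} βs∈toF = to-reflects-⊆ φ (subst (_⊆ set M₂ (to φ F)) (β-points s)
                                               (cl-least M₂ (proj₂ (to φ F)) (⁅x⁆⊆ βs∈toF)))
                                        (⊆-cl M₁ (x∈⁅x⁆ s))

  cl-image : ∀ A → cl M₂ (image β A) ≡ image β (cl M₁ A)
  cl-image A = ⊆-antisym
    (cl-least M₂ (subst (IsFlat M₂) (sym (image-flat (closure M₁ A))) (proj₂ (to φ (closure M₁ A))))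
                 (image-mono β (⊆-cl M₁)))
    (⊆-trans (image-mono β (cl-least M₁ (proj₂ F) A⊆F)) (⊆-reflexive image-F))
    where
    F : Flat M₁
    F = from φ (closure M₂ (image β A))
    image-F : image β (set M₁ F) ≡ cl M₂ (image β A)
    image-F = trans (image-flat F) (to-from φ (closure M₂ (image β A)))
    A⊆F : A ⊆ set M₁ F
    A⊆F = image-reflects-⊆ β (⊆-trans (⊆-cl M₂) (⊆-reflexive (sym image-F)))

theorem6p4 : {n₁ n₂ : ℕ} (M₁ : Matroid n₁) (M₂ : Matroid n₂)
    → (α : LatticeIso M₁ M₂)
    → (∀ F → ∣ set M₂ (to α F) ∣ ≡ ∣ set M₁ F ∣)
    → M₁ ≅ M₂
theorem6p4 M₁ M₂ α ∣α∣ =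
  let φ = latticeIso⇒orderIso α
      β , β-points = point-permutation φ ∣α∣
  in  β , cl-image⇒r-image M₁ M₂ β (cl-image φ β β-points)
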